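{- Let $G$ be a graph with coloring $\mathrm{col}$, and let $u,v$ be true twins in $G$ (i.e., $N[u]=N[v]$) with $\mathrm{col}(u)=\mathrm{col}(v)$. Then $\mathrm{OPT}_{\mathrm{Free}}(G-v,\mathrm{col}|_{G-v})=\mathrm{OPT}_{\mathrm{Free}}(G,\mathrm{col})$.
   Context: For a graph $G=(V,E)$ and a coloring $\mathrm{col}\colon V\to[c_{\max}]$, $\mathrm{Comp}(\mathrm{col},u)$ denotes the monochromatic connected component containing $u$. A move is a pair $(u,c)$ with $u\in V$ and $c\in[c_{\max}]$; its result is the coloring obtained by recoloring every vertex of $\mathrm{Comp}(\mathrm{col},u)$ with $c$, other vertices unchanged. $\mathrm{OPT}_{\mathrm{Free}}(G,\mathrm{col})$ is the minimum number of moves in a sequence (applied successively) whose result is a constant coloring. $N[x]$ denotes the closed neighborhood of $x$. -}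

module Defs where

open import Data.Nat using (ℕ; zero; suc; _≤_)
open import Data.Fin using (Fin; punchIn)
open import Data.Bool using (Bool; true; false)
open import Data.Product using (Σ; ∃; _×_; _,_)
open import Data.Sum using (_⊎_)
open import Relation.Nullary using (¬_)
open import Relation.Binary.PropositionalEquality using (_≡_)

record Graph (n : ℕ) : Set where
  field
    adj   : Fin n → Fin n → Bool
    sym   : ∀ x y → adj x y ≡ adj y x
    irrefl : ∀ x → adj x x ≡ false
open Graph public

Adj : ∀ {n} → Graph n → Fin n → Fin n → Set
Adj G x y = adj G x y ≡ true

Coloring : ℕ → ℕ → Set
Coloring n cmax = Fin n → Fin cmax

data Comp {n cmax} (G : Graph n) (col : Coloring n cmax) (u : Fin n) : Fin n → Set where
  here : Comp G col u u
  step : ∀ {w x} → Comp G col u w → Adj G w x → col w ≡ col x → Comp G col u x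

MoveResult : ∀ {n cmax} → Graph n → Coloring n cmax → Fin n → Fin cmax → Coloring n cmax → Set
MoveResult G col u c col' =
  ∀ w → (Comp G col u w → col' w ≡ c) × (¬ Comp G col u w → col' w ≡ col w)

data Steps {n cmax} (G : Graph n) : ℕ → Coloring n cmax → Coloring n cmax → Set where
  done : ∀ {col} → Steps G zero col col
  move : ∀ {k col col₁ col'} (u : Fin n) (c : Fin cmax) →
         MoveResult G col u c col₁ → Steps G k col₁ col' → Steps G (suc k) col col'

Constant : ∀ {n cmax} → Coloring n cmax → Set
Constant {n} {cmax} col = Σ (Fin cmax) λ c → ∀ w → col w ≡ c

Solvable : ∀ {n cmax} → Graph n → Coloring n cmax → ℕ → Set
Solvable G col k = Σ _ λ col' → Steps G k col col' × Constant col'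

IsOPTFree : ∀ {n cmax} → Graph n → Coloring n cmax → ℕ → Set
IsOPTFree G col k = Solvable G col k × (∀ k' → Solvable G col k' → k ≤ k')

InClosedNbhd : ∀ {n} → Graph n → Fin n → Fin n → Set
InClosedNbhd G x w = w ≡ x ⊎ Adj G x w

deleteVertex : ∀ {n} → Graph (suc n) → Fin (suc n) → Graph n
deleteVertex G v = record
  { adj = λ i j → adj G (punchIn v i) (punchIn v j)
  ; sym = λ i j → sym G (punchIn v i) (punchIn v j)
  ; irrefl = λ i → irrefl G (punchIn v i) }

restrict : ∀ {n cmax} → Coloring (suc n) cmax → Fin (suc n) → Coloring n cmax
restrict col v i = col (punchIn v i)

-- Idea: write u = punchIn v u' and let  collapse : V(G) → V(G - v)  send v
-- to u' and every other vertex to itself.  Call a colouring e of G a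
-- collapse of a colouring d of G - v when e = d ∘ collapse.  Because u and v
-- are adjacent twins, collapse maps edges of G to edges (or loops) of G - v,
-- and every vertex w is e-monochromatically joined to punchIn v (collapse w);
-- hence e-components of G are exactly the preimages of d-components of
-- G - v.  Consequently a move (x, c) in G - v is mirrored by the move
-- (punchIn v x, c) in G and a move (y, c) in G by (collapse y, c) in G - v,
-- and both moves preserve the collapse relation.  Induction on the number of
-- moves shows that d and e are solvable in exactly the same numbers of
-- moves, so they have the same OPT_Free.  Finally col is a collapse of its
-- restriction to G - v precisely because col u ≡ col v.
module Submission where

open import Defs
open import Data.Nat using (ℕ; suc)
open import Data.Fin using (Fin; punchIn; punchOut; _≟_)
open import Data.Fin.Properties
  using (punchIn-injective; punchInᵢ≢i; punchIn-punchOut; punchOut-cong; punchOut-punchIn)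
open import Data.Product using (Σ; _×_; _,_; proj₁; proj₂)
open import Data.Sum using (_⊎_; inj₁; inj₂) renaming (map to ⊎-map)
open import Data.Empty using (⊥-elim)
open import Function using (_∘_)
open import Function.Bundles using (_⇔_; mk⇔; Equivalence)
open import Relation.Nullary using (¬_; yes; no)
open import Relation.Nullary.Decidable using (decidable-stable)
open import Relation.Binary.PropositionalEquality
  using (_≡_; refl; trans; cong; subst) renaming (sym to ≡-sym)

open Equivalence using (to; from)

adj-sym : ∀ {n} (H : Graph n) {a b} → Adj H a b → Adj H b a
adj-sym H {a} {b} a~b = trans (Graph.sym H b a) a~b

no-loop : ∀ {n} (H : Graph n) {a} → ¬ Adj H a a
no-loop H {a} a~a with trans (≡-sym a~a) (irrefl H a)
... | ()

comp-trans : ∀ {n cmax} {H : Graph n} {col : Coloring n cmax} {a b w} →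
             Comp H col a b → Comp H col b w → Comp H col a w
comp-trans a⇝b here              = a⇝b
comp-trans a⇝b (step b⇝w w~x cw) = step (comp-trans a⇝b b⇝w) w~x cw

comp-sym : ∀ {n cmax} {H : Graph n} {col : Coloring n cmax} {a b} →
           Comp H col a b → Comp H col b a
comp-sym here = here
comp-sym {H = H} (step a⇝w w~x cw) =
  comp-trans (step here (adj-sym H w~x) (≡-sym cw)) (comp-sym a⇝w)

comp-colour : ∀ {n cmax} {H : Graph n} {col : Coloring n cmax} {a b} →
              Comp H col a b → col a ≡ col b
comp-colour here                = refl
comp-colour (step a⇝w _ cw)  = trans (comp-colour a⇝w) cw

-- A move recolours whole components, so two vertices in one component before
-- the move still share their colour afterwards.
move-preserves-component :
  ∀ {n cmax} {H : Graph n} {col col₁ : Coloring n cmax} {y c w w'} →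
  MoveResult H col y c col₁ → Comp H col w w' → col₁ w ≡ col₁ w'
move-preserves-component {col = col} {col₁} {y} {w = w} {w'} mr w⇝w' =
  decidable-stable (col₁ w ≟ col₁ w') λ differ →
    let y↛w : ¬ Comp _ col y w
        y↛w y⇝w = differ (trans (proj₁ (mr w) y⇝w)
                                 (≡-sym (proj₁ (mr w') (comp-trans y⇝w w⇝w'))))
        y↛w' : ¬ Comp _ col y w'
        y↛w' y⇝w' = y↛w (comp-trans y⇝w' (comp-sym w⇝w'))
    in differ (trans (proj₂ (mr w) y↛w)
                     (trans (comp-colour w⇝w') (≡-sym (proj₂ (mr w') y↛w'))))

optFree-cong :
  ∀ {m n cmax} {H : Graph m} {H' : Graph n} {d : Coloring m cmax} {e : Coloring n cmax} →
  (∀ k → Solvable H d k ⇔ Solvable H' e k) → ∀ k → IsOPTFree H d k ⇔ IsOPTFree H' e k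
optFree-cong same k =
  mk⇔ (λ (sol , least) → to (same k) sol , λ k' sol' → least k' (from (same k') sol'))
      (λ (sol , least) → from (same k) sol , λ k' sol' → least k' (to (same k') sol'))

punchIn-view : ∀ {n} (v w : Fin (suc n)) → w ≡ v ⊎ Σ (Fin n) λ j → punchIn v j ≡ w
punchIn-view v w with v ≟ w
... | yes v≡w = inj₁ (≡-sym v≡w)
... | no  v≢w = inj₂ (punchOut v≢w , punchIn-punchOut v≢w)

-- Throughout, v is the deleted vertex and u = punchIn v u' its true twin.
module TwinCollapse {n cmax : ℕ} (G : Graph (suc n)) (v : Fin (suc n)) (u' : Fin n)
  (twins : ∀ w → InClosedNbhd G (punchIn v u') w ⇔ InClosedNbhd G v w) where

  G' : Graph n
  G' = deleteVertex G v

  ι : Fin n → Fin (suc n)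
  ι = punchIn v

  collapse : Fin (suc n) → Fin n
  collapse w with v ≟ w
  ... | yes _   = u'
  ... | no  v≢w = punchOut v≢w

  collapse-ι : ∀ j → collapse (ι j) ≡ j
  collapse-ι j with v ≟ ι j
  ... | yes v≡ιj = ⊥-elim (punchInᵢ≢i v j (≡-sym v≡ιj))
  ... | no  _    = trans (punchOut-cong v refl) (punchOut-punchIn v)

  collapse-v : collapse v ≡ u'
  collapse-v with v ≟ v
  ... | yes _   = refl
  ... | no  v≢v = ⊥-elim (v≢v refl)

  twins-adjacent : Adj G v (ι u')
  twins-adjacent with to (twins (ι u')) (inj₁ refl)
  ... | inj₁ ιu'≡v = ⊥-elim (punchInᵢ≢i v u' ιu'≡v)
  ... | inj₂ v~u   = v~u

  deleted-edge : ∀ i → Adj G v (ι i) → u' ≡ i ⊎ Adj G' u' i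
  deleted-edge i v~i with from (twins (ι i)) (inj₂ v~i)
  ... | inj₁ ιi≡ιu' = inj₁ (punchIn-injective v u' i (≡-sym ιi≡ιu'))
  ... | inj₂ u~i    = inj₂ u~i

  collapse-edge : ∀ {w z} → Adj G w z → collapse w ≡ collapse z ⊎ Adj G' (collapse w) (collapse z)
  collapse-edge {w} {z} w~z with punchIn-view v w | punchIn-view v z
  ... | inj₁ refl | inj₁ refl = ⊥-elim (no-loop G w~z)
  ... | inj₁ refl | inj₂ (i , refl)
    rewrite collapse-v | collapse-ι i = deleted-edge i w~z
  ... | inj₂ (j , refl) | inj₁ refl
    rewrite collapse-v | collapse-ι j =
      ⊎-map ≡-sym (adj-sym G') (deleted-edge j (adj-sym G w~z))
  ... | inj₂ (j , refl) | inj₂ (i , refl)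
    rewrite collapse-ι j | collapse-ι i = inj₂ w~z

  near-representative : ∀ w → w ≡ ι (collapse w) ⊎ Adj G w (ι (collapse w))
  near-representative w with punchIn-view v w
  ... | inj₁ refl       = inj₂ (subst (Adj G v) (cong ι (≡-sym collapse-v)) twins-adjacent)
  ... | inj₂ (j , refl) = inj₁ (cong ι (≡-sym (collapse-ι j)))

  Collapses : Coloring n cmax → Coloring (suc n) cmax → Set
  Collapses d e = ∀ w → e w ≡ d (collapse w)

  module Components (d : Coloring n cmax) (e : Coloring (suc n) cmax)
                    (e≡d∘collapse : Collapses d e) where

    e∘ι≡d : ∀ j → e (ι j) ≡ d j
    e∘ι≡d j = trans (e≡d∘collapse (ι j)) (cong d (collapse-ι j))

    -- Walks of G project to walks of G - v (twin edges become loops).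
    descend : ∀ {a b} → Comp G e a b → Comp G' d (collapse a) (collapse b)
    descend here = here
    descend {a} (step {w} {z} a⇝w w~z ew≡ez) with collapse-edge w~z
    ... | inj₁ same = subst (Comp G' d (collapse a)) same (descend a⇝w)
    ... | inj₂ edge = step (descend a⇝w) edge
      (trans (≡-sym (e≡d∘collapse w)) (trans ew≡ez (e≡d∘collapse z)))

    ascend : ∀ {x y} → Comp G' d x y → Comp G e (ι x) (ι y)
    ascend here = here
    ascend (step {w} {z} x⇝w w~z dw≡dz) =
      step (ascend x⇝w) w~z (trans (e∘ι≡d w) (trans dw≡dz (≡-sym (e∘ι≡d z))))

    to-representative : ∀ w → Comp G e w (ι (collapse w))
    to-representative w with near-representative w
    ... | inj₁ w≡rep = subst (Comp G e w) w≡rep here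
    ... | inj₂ w~rep = step here w~rep
      (trans (e≡d∘collapse w) (≡-sym (e∘ι≡d (collapse w))))

    comp-collapse : ∀ a b → Comp G e a b ⇔ Comp G' d (collapse a) (collapse b)
    comp-collapse a b = mk⇔ descend λ a'⇝b' →
      comp-trans (to-representative a)
                 (comp-trans (ascend a'⇝b') (comp-sym (to-representative b)))

    comp-from-ι : ∀ x w → Comp G e (ι x) w ⇔ Comp G' d x (collapse w)
    comp-from-ι x w = subst (λ t → Comp G e (ι x) w ⇔ Comp G' d t (collapse w))
                            (collapse-ι x) (comp-collapse (ι x) w)

    comp-to-ι : ∀ y j → Comp G e y (ι j) ⇔ Comp G' d (collapse y) j
    comp-to-ι y j = subst (λ t → Comp G e y (ι j) ⇔ Comp G' d (collapse y) t)
                          (collapse-ι j) (comp-collapse y (ι j))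

  open Components

  lift-move : ∀ {d e d₁ x c} → Collapses d e → MoveResult G' d x c d₁ →
              MoveResult G e (ι x) c (d₁ ∘ collapse)
  lift-move {d} {e} {x = x} coll mr w =
    (λ ιx⇝w → proj₁ (mr (collapse w)) (to (comp-from-ι d e coll x w) ιx⇝w)) ,
    (λ ιx↛w → trans (proj₂ (mr (collapse w)) (ιx↛w ∘ from (comp-from-ι d e coll x w)))
                     (≡-sym (coll w)))

  project-move : ∀ {d e e₁ y c} → Collapses d e → MoveResult G e y c e₁ →
                 MoveResult G' d (collapse y) c (e₁ ∘ ι) × Collapses (e₁ ∘ ι) e₁
  project-move {d} {e} {y = y} coll mr =
    (λ j → (λ y'⇝j → proj₁ (mr (ι j)) (from (comp-to-ι d e coll y j) y'⇝j)) ,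
           (λ y'↛j → trans (proj₂ (mr (ι j)) (y'↛j ∘ to (comp-to-ι d e coll y j)))
                            (e∘ι≡d d e coll j))) ,
    (λ w → move-preserves-component mr (to-representative d e coll w))

  solve-in-G : ∀ {k d d' e} → Collapses d e → Steps G' k d d' → Constant d' → Solvable G e k
  solve-in-G {e = e} coll done (c , d≡c) = e , done , c , λ w → trans (coll w) (d≡c _)
  solve-in-G coll (move x c mr rest) final =
    let (f , steps , f-const) = solve-in-G (λ _ → refl) rest final
    in f , move (ι x) c (lift-move coll mr) steps , f-const

  solve-in-G' : ∀ {k d e e'} → Collapses d e → Steps G k e e' → Constant e' → Solvable G' d k
  solve-in-G' {d = d} {e} coll done (c , e≡c) =
    d , done , c , λ j → trans (≡-sym (e∘ι≡d d e coll j)) (e≡c (ι j))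
  solve-in-G' coll (move y c mr rest) final =
    let (mr' , coll₁) = project-move coll mr
        (f , steps , f-const) = solve-in-G' coll₁ rest final
    in f , move (collapse y) c mr' steps , f-const

  solvable-collapse : ∀ {d e} → Collapses d e → ∀ k → Solvable G' d k ⇔ Solvable G e k
  solvable-collapse coll k =
    mk⇔ (λ (_ , steps , final) → solve-in-G coll steps final)
        (λ (_ , steps , final) → solve-in-G' coll steps final)

  restrict-collapses : ∀ (col : Coloring (suc n) cmax) → col (ι u') ≡ col v →
                       Collapses (restrict col v) col
  restrict-collapses col cu≡cv w with punchIn-view v w
  ... | inj₁ refl       = trans (≡-sym cu≡cv) (cong (col ∘ ι) (≡-sym collapse-v))
  ... | inj₂ (j , refl) = cong (col ∘ ι) (≡-sym (collapse-ι j))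

lemma12 : ∀ {n cmax} (G : Graph (suc n)) (col : Coloring (suc n) cmax) (u v : Fin (suc n)) →
    ¬ (u ≡ v) → (∀ w → InClosedNbhd G u w ⇔ InClosedNbhd G v w) → col u ≡ col v →
    ∀ k → IsOPTFree (deleteVertex G v) (restrict col v) k ⇔ IsOPTFree G col k
lemma12 G col u v u≢v twins cu≡cv with v ≟ u
... | yes v≡u = ⊥-elim (u≢v (≡-sym v≡u))
... | no  v≢u = optFree-cong (solvable-collapse (restrict-collapses col cu'≡cv))
  where
  ιu'≡u : punchIn v (punchOut v≢u) ≡ u
  ιu'≡u = punchIn-punchOut v≢u

  open TwinCollapse G v (punchOut v≢u)
    (subst (λ t → ∀ w → InClosedNbhd G t w ⇔ InClosedNbhd G v w) (≡-sym ιu'≡u) twins)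

  cu'≡cv : col (punchIn v (punchOut v≢u)) ≡ col v
  cu'≡cv = trans (cong col ιu'≡u) cu≡cv
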